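{- Let $k\geq 2$ and let $F_k$ be the free group on generators $a_1,\dots,a_k$. Let $W\subset F_k$ be a subset such that $[[x_1,x_2],[x_3,x_4]]=1$ for all $x_1,x_2,x_3,x_4\in W$. Then for every integer $m\geq 1$, $$|\{x\in W: d_T(1,x)\leq m\}|\leq(4m+1)(8m+1)\leq 45m^2,$$ where $T$ is the Cayley graph $\mathrm{Cay}(F_k,S)$ with $S=\{a_i^{\pm1}\}$ (a regular tree) and $d_T$ its graph distance.
   Context: $[x,y]=xyx^{ -1}y^{ -1}$ denotes the commutator. -}

module Defs where

open import Data.Nat using (ℕ; zero; suc)
open import Data.Fin using (Fin)
import Data.Fin as Fin
open import Data.Bool using (Bool; true; false; not; _xor_; if_then_else_; _∧_)
open import Data.Product using (_×_; _,_)
open import Data.List using (List; []; _∷_; _++_; foldr; reverse; map; length)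
open import Data.Unit using (⊤)
open import Data.Empty using (⊥)
open import Relation.Nullary.Decidable using (⌊_⌋)

-- A letter of the free group F_k on generators a_0, …, a_(k-1):
-- (i , true) stands for a_i and (i , false) for a_i⁻¹.
Letter : ℕ → Set
Letter k = Fin k × Bool

Word : ℕ → Set
Word k = List (Letter k)

cancels : ∀ {k} → Letter k → Letter k → Bool
cancels (i , b) (j , c) = ⌊ i Fin.≟ j ⌋ ∧ (b xor c)

-- Freely reduced words: no adjacent mutually inverse letters.
-- These are the elements of F_k (normal forms).
IsReduced : ∀ {k} → Word k → Set
IsReduced [] = ⊤
IsReduced (x ∷ []) = ⊤
IsReduced (x ∷ y ∷ w) = if cancels x y then ⊥ else IsReduced (y ∷ w)

push : ∀ {k} → Letter k → Word k → Word k
push l [] = l ∷ []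
push l (l' ∷ w) = if cancels l l' then w else (l ∷ l' ∷ w)

reduce : ∀ {k} → Word k → Word k
reduce = foldr push []

_·_ : ∀ {k} → Word k → Word k → Word k
x · y = reduce (x ++ y)

inv : ∀ {k} → Word k → Word k
inv x = reverse (map (λ { (i , b) → (i , not b) }) x)

⟦_,_⟧ : ∀ {k} → Word k → Word k → Word k
⟦ x , y ⟧ = ((x · y) · inv x) · inv y

-- Distance d_T(1,x) in the Cayley tree Cay(F_k,S) = length of the
-- reduced word representing x.
dist₁ : ∀ {k} → Word k → ℕ
dist₁ = length

module Submission where

-- The key structural fact is the
-- description of centralizers: a nontrivial reduced g is literally u c u⁻¹ with c
-- cyclically reduced, and every reduced h commuting with g is u s^{±1} u⁻¹ where s
-- commutes with c as a string, hence is the prefix of length ℓ ≤ |h| of c c c ⋯.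
-- Consequently the centralizer of g ≠ 1 is commutative and has at most 2n + 1
-- elements of length ≤ n; if g has zero exponent sums (e.g. g is a commutator),
-- then no two consecutive lengths occur, so at most 2n + 1 of length ≤ 2n.
-- If all points of W in the ball commute, they lie in one centralizer: 2m + 1
-- points.  Otherwise some [x,y] ≠ 1, and z ↦ ([x,z],[y,z]) injects the points into
-- pairs of centralizer elements of [x,y] of length ≤ 4m: (4m + 1)² points.

open import Defs
open import Data.Nat using (ℕ; _≤_; _*_; _+_)
open import Data.List using (List; [])
open import Data.List.Relation.Unary.All using (All)
open import Data.List.Relation.Unary.Unique.Propositional using (Unique)
open import Data.Product using (_×_)
open import Relation.Binary.PropositionalEquality using (_≡_)

open import Level using (0ℓ)
open import Algebra.Bundles using (Group)
open import Data.Nat using (zero; suc; _<_; z≤n; s≤s)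
open import Data.Nat.Properties
  using (≤-refl; ≤-trans; ≤-reflexive; <-≤-trans; ≤-<-trans; <-irrefl; n≤1+n; m≤n⇒m≤1+n;
         m≤m*n; m≤n⇒m⊓n≡m; +-comm; +-assoc; +-suc; suc-injective; 0≢1+n;
         m≤n⇒m<n∨m≡n; _<?_; ≮⇒≥; +-mono-≤; m≤m+n; module ≤-Reasoning)
open import Data.Bool using (Bool; true; false; not; _xor_; if_then_else_)
import Data.Bool.Properties as Bool
open import Data.Fin using (Fin)
import Data.Fin as Fin
open import Data.Product using (Σ-syntax; _,_; proj₁; proj₂)
import Data.Product.Properties as Product
open import Data.Sum using (_⊎_; inj₁; inj₂)
import Data.Sum as Sum
open import Data.List
  using (_∷_; _++_; foldr; reverse; map; length; [_]; _∷ʳ_; take; replicate; InitLast; initLast; _∷ʳ′_;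
         cartesianProduct)
open import Data.List.Properties
  using (∷-injective; ∷-injectiveˡ; ∷ʳ-injective; ∷ʳ-injectiveʳ; ++-assoc; ++-identityʳ;
         length-++; length-map; length-reverse; map-++; map-cong; reverse-++;
         foldr-++; ++-cancelˡ; ++-conicalʳ; length-take; length-++-≤ˡ; length-++-≤ʳ)
import Data.List.Properties as List
open import Data.Unit using (tt)
open import Data.Empty using (⊥; ⊥-elim)
open import Relation.Nullary using (¬_; Dec; yes; no; ¬?)
open import Relation.Nullary.Decidable using (⌊_⌋; decidable-stable)
open import Function using (case_of_; _∘_; id)
import Data.List.Relation.Unary.All as All
open import Data.List.Relation.Unary.AllPairs using (_∷_)
open import Data.List.Relation.Unary.Any using (here; there; any?)
open import Data.List.Membership.Propositional using (_∈_; find; lose)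
open import Data.List.Membership.Propositional.Properties using (∈-∃++; ∈-cartesianProduct⁺)
open import Data.Integer using (ℤ; +_; -_; -[1+_]) renaming (_+_ to _⊕_)
import Data.Integer.Properties as ℤ
open import Data.Integer.Tactic.RingSolver using (solve-∀)
import Data.Nat.Tactic.RingSolver as NatSolver
open import Relation.Binary.PropositionalEquality
  using (_≢_; refl; sym; trans; cong; cong₂; subst; module ≡-Reasoning)

true≢false : true ≢ false
true≢false ()

module _ {A : Set} where

  StartsWith : List A → A → Set
  StartsWith v q = Σ[ v' ∈ List A ] v ≡ q ∷ v'

  EndsWith : List A → A → Set
  EndsWith u p = Σ[ u' ∈ List A ] u ≡ u' ++ [ p ]

  starts-++ : ∀ {v : List A} {q} w → StartsWith v q → StartsWith (v ++ w) q
  starts-++ w (v' , e) = v' ++ w , cong (_++ w) e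

  ends-++ : ∀ {u : List A} {p} w → EndsWith u p → EndsWith (w ++ u) p
  ends-++ {p = p} w (u' , e) = w ++ u' , trans (cong (w ++_) e) (sym (++-assoc w u' [ p ]))

  last-of : ∀ (x : A) xs → Σ[ l ∈ A ] EndsWith (x ∷ xs) l
  last-of x [] = x , [] , refl
  last-of x (y ∷ xs) with last-of y xs
  ... | l , ys , e = l , x ∷ ys , cong (x ∷_) e

module _ {k : ℕ} where

  invL : Letter k → Letter k
  invL (i , b) = (i , not b)

  invL-involutive : ∀ p → invL (invL p) ≡ p
  invL-involutive (i , b) = cong (i ,_) (Bool.not-involutive b)

  cancels-invL : ∀ p → cancels p (invL p) ≡ true
  cancels-invL (i , b) with i Fin.≟ i
  ... | yes _ = lemma b
    where
    lemma : ∀ b → b xor not b ≡ true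
    lemma true = refl
    lemma false = refl
  ... | no i≢i = ⊥-elim (i≢i refl)

  cancels⇒invL : ∀ p q → cancels p q ≡ true → q ≡ invL p
  cancels⇒invL (i , b) (j , c) e with i Fin.≟ j
  cancels⇒invL (i , b) (.i , c) e | yes refl = cong (i ,_) (lemma b c e)
    where
    lemma : ∀ b c → b xor c ≡ true → c ≡ not b
    lemma true false _ = refl
    lemma false true _ = refl
  cancels⇒invL (i , b) (j , c) () | no _

  ¬invL⇒¬cancels : ∀ p q → q ≢ invL p → cancels p q ≡ false
  ¬invL⇒¬cancels p q q≢p⁻¹ with cancels p q in e
  ... | true = ⊥-elim (q≢p⁻¹ (cancels⇒invL p q e))
  ... | false = refl

  invL-cancels : ∀ p → cancels (invL p) p ≡ true
  invL-cancels p =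
    subst (λ q → cancels (invL p) q ≡ true) (invL-involutive p) (cancels-invL (invL p))

  cancels-sym : ∀ p q → cancels p q ≡ true → cancels q p ≡ true
  cancels-sym p q e rewrite cancels⇒invL p q e = invL-cancels p

  cancels-self : ∀ p → cancels p p ≡ false
  cancels-self (i , b) = ¬invL⇒¬cancels (i , b) (i , b) (λ e → Bool.not-¬ refl (cong proj₂ e))

  infix 4 _≟L_ _≟W_

  _≟L_ : (p q : Letter k) → Dec (p ≡ q)
  _≟L_ = Product.≡-dec Fin._≟_ Bool._≟_

  _≟W_ : (x y : Word k) → Dec (x ≡ y)
  _≟W_ = List.≡-dec _≟L_

module _ {k : ℕ} where

  reduced-tail : ∀ (x : Letter k) w → IsReduced (x ∷ w) → IsReduced w
  reduced-tail x [] r = tt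
  reduced-tail x (y ∷ w) r with cancels x y
  ... | true = ⊥-elim r
  ... | false = r

  reduced-head : ∀ (x y : Letter k) w → IsReduced (x ∷ y ∷ w) → cancels x y ≡ false
  reduced-head x y w r with cancels x y
  ... | true = ⊥-elim r
  ... | false = refl

  reduced-cons : ∀ (x y : Letter k) w → IsReduced (y ∷ w) → cancels x y ≡ false
    → IsReduced (x ∷ y ∷ w)
  reduced-cons x y w r e rewrite e = r

  reduced? : (w : Word k) → Dec (IsReduced w)
  reduced? [] = yes tt
  reduced? (x ∷ []) = yes tt
  reduced? (x ∷ y ∷ w) with reduced? (y ∷ w) | cancels x y
  ... | _ | true = no (λ r → r)
  ... | d | false = d

  reduced-prefix : ∀ (u v : Word k) → IsReduced (u ++ v) → IsReduced u
  reduced-prefix [] v r = tt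
  reduced-prefix (x ∷ []) v r = tt
  reduced-prefix (x ∷ y ∷ u) v r =
    reduced-cons x y u (reduced-prefix (y ∷ u) v (reduced-tail x (y ∷ u ++ v) r))
      (reduced-head x y (u ++ v) r)

  reduced-inner : ∀ (u : Word k) p q v → IsReduced (u ++ p ∷ q ∷ v) → cancels p q ≡ false
  reduced-inner [] p q v r = reduced-head p q v r
  reduced-inner (x ∷ u) p q v r = reduced-inner u p q v (reduced-tail x (u ++ p ∷ q ∷ v) r)

  Compatible : Word k → Word k → Set
  Compatible u v = ∀ {p q} → EndsWith u p → StartsWith v q → cancels p q ≡ false

  boundary-compatible : ∀ {u v : Word k} {p q} → EndsWith u p → StartsWith v q
    → cancels p q ≡ false → Compatible u v
  boundary-compatible (u' , refl) (v' , refl) f (u'' , e₁) (v'' , e₂)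
    with ∷ʳ-injective u' u'' e₁ | ∷-injective e₂
  ... | _ , refl | refl , _ = f

  reduced-++⇒compatible : ∀ (u v : Word k) → IsReduced (u ++ v) → Compatible u v
  reduced-++⇒compatible u v r {p} {q} (u' , refl) (v' , refl) =
    reduced-inner u' p q v' (subst IsReduced (++-assoc u' [ p ] (q ∷ v')) r)

  ++-reduced : ∀ (u v : Word k) → IsReduced u → IsReduced v → Compatible u v
    → IsReduced (u ++ v)
  ++-reduced [] v _ rv _ = rv
  ++-reduced (p ∷ []) [] _ _ _ = tt
  ++-reduced (p ∷ []) (q ∷ v) _ rv j = reduced-cons p q v rv (j ([] , refl) (v , refl))
  ++-reduced (p ∷ p' ∷ u) v ru rv j =
    reduced-cons p p' (u ++ v) (++-reduced (p' ∷ u) v (reduced-tail p (p' ∷ u) ru) rv j')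
      (reduced-head p p' u ru)
    where
    j' : Compatible (p' ∷ u) v
    j' (u' , e) = j (p ∷ u' , cong (p ∷_) e)

module _ {k : ℕ} where

  push-reduced : ∀ (l : Letter k) w → IsReduced w → IsReduced (push l w)
  push-reduced l [] r = tt
  push-reduced l (y ∷ w) r with cancels l y in e
  ... | true = reduced-tail y w r
  ... | false = reduced-cons l y w r e

  reduce-reduced : ∀ (w : Word k) → IsReduced (reduce w)
  reduce-reduced [] = tt
  reduce-reduced (x ∷ w) = push-reduced x (reduce w) (reduce-reduced w)

  push-fixes : ∀ (x : Letter k) w → IsReduced (x ∷ w) → push x w ≡ x ∷ w
  push-fixes x [] r = refl
  push-fixes x (y ∷ w) r with cancels x y
  ... | true = ⊥-elim r
  ... | false = refl

  reduce-fixes : ∀ (w : Word k) → IsReduced w → reduce w ≡ w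
  reduce-fixes [] r = refl
  reduce-fixes (x ∷ w) r
    rewrite reduce-fixes w (reduced-tail x w r) = push-fixes x w r

  reduce-idempotent : ∀ (w : Word k) → reduce (reduce w) ≡ reduce w
  reduce-idempotent w = reduce-fixes (reduce w) (reduce-reduced w)

  reduced-unique : ∀ (a b : Word k) → IsReduced a → IsReduced b → reduce a ≡ reduce b → a ≡ b
  reduced-unique a b ra rb e = trans (sym (reduce-fixes a ra)) (trans e (reduce-fixes b rb))

  push-cancels : ∀ (a b : Letter k) w → cancels a b ≡ true → push a (b ∷ w) ≡ w
  push-cancels a b w e rewrite e = refl

  push-invL-push : ∀ (a : Letter k) w → IsReduced w → push (invL a) (push a w) ≡ w
  push-invL-push a [] r = push-cancels (invL a) a [] (invL-cancels a)
  push-invL-push a (y ∷ w) r with cancels a y in e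
  ... | true rewrite cancels⇒invL a y e = push-fixes (invL a) w r
  ... | false = push-cancels (invL a) a (y ∷ w) (invL-cancels a)

  length-push : ∀ (l : Letter k) w → length (push l w) ≤ suc (length w)
  length-push l [] = ≤-refl
  length-push l (y ∷ w) with cancels l y
  ... | true = m≤n⇒m≤1+n (n≤1+n (length w))
  ... | false = ≤-refl

  length-reduce : ∀ (w : Word k) → length (reduce w) ≤ length w
  length-reduce [] = z≤n
  length-reduce (x ∷ w) = ≤-trans (length-push x (reduce w)) (s≤s (length-reduce w))

  private
    foldr-push-reduced : ∀ (w : Word k) u → IsReduced w → IsReduced (foldr push w u)
    foldr-push-reduced w [] r = r
    foldr-push-reduced w (x ∷ u) r = push-reduced x (foldr push w u) (foldr-push-reduced w u r)

    foldr-push-push : ∀ (w : Word k) a r → IsReduced w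
      → foldr push w (push a r) ≡ push a (foldr push w r)
    foldr-push-push w a [] rw = refl
    foldr-push-push w a (b ∷ r) rw with cancels a b in e
    ... | false = refl
    ... | true rewrite cancels⇒invL a b e =
      sym (subst (λ a' → push a' (push (invL a) (foldr push w r)) ≡ foldr push w r)
             (invL-involutive a)
             (push-invL-push (invL a) (foldr push w r) (foldr-push-reduced w r rw)))

    foldr-push-reduce : ∀ (w : Word k) u → IsReduced w
      → foldr push w (reduce u) ≡ foldr push w u
    foldr-push-reduce w [] r = refl
    foldr-push-reduce w (a ∷ u) r =
      trans (foldr-push-push w a (reduce u) r)
            (cong (push a) (foldr-push-reduce w u r))

    reduce-++ : ∀ (u v : Word k) → reduce (u ++ v) ≡ foldr push (reduce v) u
    reduce-++ u v = foldr-++ push [] u v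

  reduce-++-reduceˡ : ∀ (u v : Word k) → reduce (reduce u ++ v) ≡ reduce (u ++ v)
  reduce-++-reduceˡ u v = trans (reduce-++ (reduce u) v)
    (trans (foldr-push-reduce (reduce v) u (reduce-reduced v)) (sym (reduce-++ u v)))

  reduce-++-reduceʳ : ∀ (u v : Word k) → reduce (u ++ reduce v) ≡ reduce (u ++ v)
  reduce-++-reduceʳ u v = trans (reduce-++ u (reduce v))
    (trans (cong (λ z → foldr push z u) (reduce-idempotent v))
           (sym (reduce-++ u v)))

  reduce-shortens : ∀ (w : Word k) → ¬ IsReduced w → length (reduce w) < length w
  reduce-shortens [] nr = ⊥-elim (nr tt)
  reduce-shortens (x ∷ w) nr with reduced? w
  ... | no nw = ≤-<-trans (length-push x (reduce w)) (s≤s (reduce-shortens w nw))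
  ... | yes rw rewrite reduce-fixes w rw = push-shortens w rw nr
    where
    push-shortens : ∀ w → IsReduced w → ¬ IsReduced (x ∷ w) → length (push x w) < suc (length w)
    push-shortens [] _ nr = ⊥-elim (nr tt)
    push-shortens (y ∷ w') rw nr with cancels x y
    ... | true = s≤s (n≤1+n (length w'))
    ... | false = ⊥-elim (nr rw)

  reduced-if-not-shorter : ∀ (w : Word k) → length w ≤ length (reduce w) → IsReduced w
  reduced-if-not-shorter w le with reduced? w
  ... | yes r = r
  ... | no nr = ⊥-elim (<-irrefl refl (<-≤-trans (reduce-shortens w nr) le))

module _ {k : ℕ} where

  inv-as-map : ∀ (x : Word k) → inv x ≡ reverse (map invL x)
  inv-as-map x = cong reverse (map-cong (λ { (i , b) → refl }) x)

  inv-++ : ∀ (x y : Word k) → inv (x ++ y) ≡ inv y ++ inv x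
  inv-++ x y = begin
    inv (x ++ y)                                ≡⟨ inv-as-map (x ++ y) ⟩
    reverse (map invL (x ++ y))                 ≡⟨ cong reverse (map-++ invL x y) ⟩
    reverse (map invL x ++ map invL y)          ≡⟨ reverse-++ (map invL x) (map invL y) ⟩
    reverse (map invL y) ++ reverse (map invL x) ≡⟨ cong₂ _++_ (sym (inv-as-map y)) (sym (inv-as-map x)) ⟩
    inv y ++ inv x                              ∎
    where open ≡-Reasoning

  inv-cons : ∀ (a : Letter k) x → inv (a ∷ x) ≡ inv x ++ [ invL a ]
  inv-cons a x = inv-++ [ a ] x

  inv-snoc : ∀ (x : Word k) a → inv (x ++ [ a ]) ≡ invL a ∷ inv x
  inv-snoc x a = inv-++ x [ a ]

  inv-involutive : ∀ (x : Word k) → inv (inv x) ≡ x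
  inv-involutive [] = refl
  inv-involutive (a ∷ x) = begin
    inv (inv (a ∷ x))            ≡⟨ cong inv (inv-cons a x) ⟩
    inv (inv x ++ [ invL a ])    ≡⟨ inv-snoc (inv x) (invL a) ⟩
    invL (invL a) ∷ inv (inv x)  ≡⟨ cong₂ _∷_ (invL-involutive a) (inv-involutive x) ⟩
    a ∷ x                        ∎
    where open ≡-Reasoning

  length-inv : ∀ (x : Word k) → length (inv x) ≡ length x
  length-inv x = trans (cong length (inv-as-map x))
    (trans (length-reverse (map invL x)) (length-map invL x))

  reduce-inv-++ : ∀ (x : Word k) → reduce (inv x ++ x) ≡ []
  reduce-inv-++ [] = refl
  reduce-inv-++ (a ∷ x) = begin
    reduce (inv (a ∷ x) ++ a ∷ x)              ≡⟨ cong (λ z → reduce (z ++ a ∷ x)) (inv-cons a x) ⟩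
    reduce ((inv x ++ [ invL a ]) ++ a ∷ x)    ≡⟨ cong reduce (++-assoc (inv x) _ _) ⟩
    reduce (inv x ++ (invL a ∷ a ∷ x))         ≡⟨ sym (reduce-++-reduceʳ (inv x) _) ⟩
    reduce (inv x ++ reduce (invL a ∷ a ∷ x))  ≡⟨ cong (λ z → reduce (inv x ++ z)) (push-invL-push a (reduce x) (reduce-reduced x)) ⟩
    reduce (inv x ++ reduce x)                 ≡⟨ reduce-++-reduceʳ (inv x) x ⟩
    reduce (inv x ++ x)                        ≡⟨ reduce-inv-++ x ⟩
    []                                         ∎
    where open ≡-Reasoning

  reduce-++-inv : ∀ (x : Word k) → reduce (x ++ inv x) ≡ []
  reduce-++-inv x = subst (λ z → reduce (z ++ inv x) ≡ []) (inv-involutive x) (reduce-inv-++ (inv x))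

  inv-cong : ∀ (x y : Word k) → reduce x ≡ reduce y → reduce (inv x) ≡ reduce (inv y)
  inv-cong x y e = begin
    reduce (inv x)                          ≡⟨ cong reduce (sym (++-identityʳ (inv x))) ⟩
    reduce (inv x ++ [])                    ≡⟨ cong (λ z → reduce (inv x ++ z)) (sym (reduce-++-inv y)) ⟩
    reduce (inv x ++ reduce (y ++ inv y))   ≡⟨ reduce-++-reduceʳ (inv x) _ ⟩
    reduce (inv x ++ (y ++ inv y))          ≡⟨ cong reduce (sym (++-assoc (inv x) y (inv y))) ⟩
    reduce ((inv x ++ y) ++ inv y)          ≡⟨ sym (reduce-++-reduceˡ (inv x ++ y) (inv y)) ⟩
    reduce (reduce (inv x ++ y) ++ inv y)   ≡⟨ cong (λ z → reduce (z ++ inv y)) inv-x-y ⟩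
    reduce (inv y)                          ∎
    where
    open ≡-Reasoning
    inv-x-y : reduce (inv x ++ y) ≡ []
    inv-x-y = begin
      reduce (inv x ++ y)         ≡⟨ sym (reduce-++-reduceʳ (inv x) y) ⟩
      reduce (inv x ++ reduce y)  ≡⟨ cong (λ z → reduce (inv x ++ z)) (sym e) ⟩
      reduce (inv x ++ reduce x)  ≡⟨ reduce-++-reduceʳ (inv x) x ⟩
      reduce (inv x ++ x)         ≡⟨ reduce-inv-++ x ⟩
      []                          ∎

  -- The inverse of a reduced word is reduced: it has the same length as the
  -- normal form of its own inverse.
  inv-reduced : ∀ (y : Word k) → IsReduced y → IsReduced (inv y)
  inv-reduced y ry = reduced-if-not-shorter (inv y) (begin
    length (inv y)                         ≡⟨ length-inv y ⟩
    length y                               ≡⟨ cong length (sym y≈) ⟩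
    length (reduce (inv (reduce (inv y)))) ≤⟨ length-reduce (inv (reduce (inv y))) ⟩
    length (inv (reduce (inv y)))          ≡⟨ length-inv (reduce (inv y)) ⟩
    length (reduce (inv y))                ∎)
    where
    open ≤-Reasoning
    y≈ : reduce (inv (reduce (inv y))) ≡ y
    y≈ = trans (inv-cong (reduce (inv y)) (inv y) (reduce-idempotent (inv y)))
           (trans (cong reduce (inv-involutive y)) (reduce-fixes y ry))

FreeGroup : ℕ → Group 0ℓ 0ℓ
FreeGroup k = record
  { Carrier = Word k
  ; _≈_ = λ x y → reduce x ≡ reduce y
  ; _∙_ = _++_
  ; ε = []
  ; _⁻¹ = inv
  ; isGroup = record
    { isMonoid = record
      { isSemigroup = record
        { isMagma = record
          { isEquivalence = record { refl = refl ; sym = sym ; trans = trans }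
          ; ∙-cong = λ {x} {y} {u} {v} → ∙-cong {x} {y} {u} {v}
          }
        ; assoc = λ x y z → cong reduce (++-assoc x y z)
        }
      ; identity = (λ x → refl) , (λ x → cong reduce (++-identityʳ x))
      }
    ; inverse = reduce-inv-++ , reduce-++-inv
    ; ⁻¹-cong = λ {x} {y} → inv-cong x y
    }
  }
  where
  ∙-cong : ∀ {x y u v : Word k} → reduce x ≡ reduce y → reduce u ≡ reduce v
    → reduce (x ++ u) ≡ reduce (y ++ v)
  ∙-cong {x} {y} {u} {v} e₁ e₂ = begin
    reduce (x ++ u)               ≡⟨ sym (reduce-++-reduceˡ x u) ⟩
    reduce (reduce x ++ u)        ≡⟨ sym (reduce-++-reduceʳ (reduce x) u) ⟩
    reduce (reduce x ++ reduce u) ≡⟨ cong₂ (λ a b → reduce (a ++ b)) e₁ e₂ ⟩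
    reduce (reduce y ++ reduce v) ≡⟨ reduce-++-reduceʳ (reduce y) v ⟩
    reduce (reduce y ++ v)        ≡⟨ reduce-++-reduceˡ y v ⟩
    reduce (y ++ v)               ∎
    where open ≡-Reasoning

⟦⟧-as-reduce : ∀ {k} (x y : Word k) → ⟦ x , y ⟧ ≡ reduce (((x ++ y) ++ inv x) ++ inv y)
⟦⟧-as-reduce x y = begin
  reduce (reduce (reduce (x ++ y) ++ inv x) ++ inv y) ≡⟨ reduce-++-reduceˡ (reduce (x ++ y) ++ inv x) (inv y) ⟩
  reduce ((reduce (x ++ y) ++ inv x) ++ inv y)        ≡⟨ cong reduce (++-assoc (reduce (x ++ y)) (inv x) (inv y)) ⟩
  reduce (reduce (x ++ y) ++ (inv x ++ inv y))        ≡⟨ reduce-++-reduceˡ (x ++ y) _ ⟩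
  reduce ((x ++ y) ++ (inv x ++ inv y))               ≡⟨ cong reduce (sym (++-assoc (x ++ y) (inv x) (inv y))) ⟩
  reduce (((x ++ y) ++ inv x) ++ inv y)               ∎
  where open ≡-Reasoning

module GroupLemmas {c ℓ} (G : Group c ℓ) where

  open Group G renaming (refl to ≈-refl; sym to ≈-sym; trans to ≈-trans)
  open import Algebra.Properties.Group G
  open import Relation.Binary.Reasoning.Setoid setoid

  Commute : Carrier → Carrier → Set ℓ
  Commute x y = x ∙ y ≈ y ∙ x

  commutator : Carrier → Carrier → Carrier
  commutator x y = ((x ∙ y) ∙ x ⁻¹) ∙ y ⁻¹

  conj : Carrier → Carrier → Carrier
  conj v a = (v ∙ a) ∙ v ⁻¹

  commute-sym : ∀ {x y} → Commute x y → Commute y x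
  commute-sym c = ≈-sym c

  commute-resp : ∀ {x x' y y'} → x ≈ x' → y ≈ y' → Commute x y → Commute x' y'
  commute-resp {x} {x'} {y} {y'} ex ey c = begin
    x' ∙ y'  ≈⟨ ∙-cong ex ey ⟨
    x ∙ y    ≈⟨ c ⟩
    y ∙ x    ≈⟨ ∙-cong ey ex ⟩
    y' ∙ x'  ∎

  commute-inv : ∀ {x y} → Commute x y → Commute (x ⁻¹) y
  commute-inv {x} {y} c = begin
    x ⁻¹ ∙ y                  ≈⟨ ∙-congˡ (//-rightDividesʳ x y) ⟨
    x ⁻¹ ∙ ((y ∙ x) ∙ x ⁻¹)   ≈⟨ ∙-congˡ (∙-congʳ (≈-sym c)) ⟩
    x ⁻¹ ∙ ((x ∙ y) ∙ x ⁻¹)   ≈⟨ ∙-congˡ (assoc x y (x ⁻¹)) ⟩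
    x ⁻¹ ∙ (x ∙ (y ∙ x ⁻¹))   ≈⟨ \\-leftDividesʳ x (y ∙ x ⁻¹) ⟩
    y ∙ x ⁻¹                  ∎

  commute-inv⁻ : ∀ {x y} → Commute (x ⁻¹) y → Commute x y
  commute-inv⁻ {x} {y} c = begin
    x ∙ y          ≈⟨ ∙-congʳ (⁻¹-involutive x) ⟨
    x ⁻¹ ⁻¹ ∙ y    ≈⟨ commute-inv c ⟩
    y ∙ x ⁻¹ ⁻¹    ≈⟨ ∙-congˡ (⁻¹-involutive x) ⟩
    y ∙ x          ∎

  commutator≈ε⇒commute : ∀ x y → commutator x y ≈ ε → Commute x y
  commutator≈ε⇒commute x y e = x∙y⁻¹≈ε⇒x≈y (x ∙ y) (y ∙ x) (begin
    (x ∙ y) ∙ (y ∙ x) ⁻¹     ≈⟨ ∙-congˡ (⁻¹-anti-homo-∙ y x) ⟩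
    (x ∙ y) ∙ (x ⁻¹ ∙ y ⁻¹)  ≈⟨ assoc (x ∙ y) (x ⁻¹) (y ⁻¹) ⟨
    commutator x y           ≈⟨ e ⟩
    ε                        ∎)

  commute⇒commutator≈ε : ∀ x y → Commute x y → commutator x y ≈ ε
  commute⇒commutator≈ε x y c = begin
    commutator x y           ≈⟨ assoc (x ∙ y) (x ⁻¹) (y ⁻¹) ⟩
    (x ∙ y) ∙ (x ⁻¹ ∙ y ⁻¹)  ≈⟨ ∙-congˡ (⁻¹-anti-homo-∙ y x) ⟨
    (x ∙ y) ∙ (y ∙ x) ⁻¹     ≈⟨ ∙-congˡ (⁻¹-cong c) ⟨
    (x ∙ y) ∙ (x ∙ y) ⁻¹     ≈⟨ inverseʳ (x ∙ y) ⟩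
    ε                        ∎

  conj-cong : ∀ v {a b} → a ≈ b → conj v a ≈ conj v b
  conj-cong v e = ∙-congʳ (∙-congˡ e)

  conj-homo : ∀ v a b → conj v a ∙ conj v b ≈ conj v (a ∙ b)
  conj-homo v a b = begin
    ((v ∙ a) ∙ v ⁻¹) ∙ ((v ∙ b) ∙ v ⁻¹) ≈⟨ assoc (v ∙ a) (v ⁻¹) _ ⟩
    (v ∙ a) ∙ (v ⁻¹ ∙ ((v ∙ b) ∙ v ⁻¹)) ≈⟨ ∙-congˡ (∙-congˡ (assoc v b (v ⁻¹))) ⟩
    (v ∙ a) ∙ (v ⁻¹ ∙ (v ∙ (b ∙ v ⁻¹))) ≈⟨ ∙-congˡ (\\-leftDividesʳ v (b ∙ v ⁻¹)) ⟩
    (v ∙ a) ∙ (b ∙ v ⁻¹)                ≈⟨ assoc (v ∙ a) b (v ⁻¹) ⟨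
    ((v ∙ a) ∙ b) ∙ v ⁻¹                ≈⟨ ∙-congʳ (assoc v a b) ⟩
    (v ∙ (a ∙ b)) ∙ v ⁻¹                ∎

  conj-∙ : ∀ u v a → conj u (conj v a) ≈ conj (u ∙ v) a
  conj-∙ u v a = begin
    (u ∙ ((v ∙ a) ∙ v ⁻¹)) ∙ u ⁻¹  ≈⟨ ∙-congʳ (assoc u (v ∙ a) (v ⁻¹)) ⟨
    ((u ∙ (v ∙ a)) ∙ v ⁻¹) ∙ u ⁻¹  ≈⟨ assoc (u ∙ (v ∙ a)) (v ⁻¹) (u ⁻¹) ⟩
    (u ∙ (v ∙ a)) ∙ (v ⁻¹ ∙ u ⁻¹)  ≈⟨ ∙-cong (assoc u v a) (⁻¹-anti-homo-∙ u v) ⟨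
    ((u ∙ v) ∙ a) ∙ (u ∙ v) ⁻¹     ∎

  conj-inverse : ∀ v a → conj (v ⁻¹) (conj v a) ≈ a
  conj-inverse v a = begin
    conj (v ⁻¹) (conj v a)  ≈⟨ conj-∙ (v ⁻¹) v a ⟩
    conj (v ⁻¹ ∙ v) a       ≈⟨ ∙-cong (∙-congʳ (inverseˡ v)) (⁻¹-cong (inverseˡ v)) ⟩
    (ε ∙ a) ∙ ε ⁻¹          ≈⟨ ∙-cong (identityˡ a) ε⁻¹≈ε ⟩
    a ∙ ε                   ≈⟨ identityʳ a ⟩
    a                       ∎

  conj-commute : ∀ v {x y} → Commute x y → Commute (conj v x) (conj v y)
  conj-commute v {x} {y} c = begin
    conj v x ∙ conj v y  ≈⟨ conj-homo v x y ⟩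
    conj v (x ∙ y)       ≈⟨ conj-cong v c ⟩
    conj v (y ∙ x)       ≈⟨ conj-homo v y x ⟨
    conj v y ∙ conj v x  ∎

  commute-conj : ∀ u x d → Commute x (conj u d) → Commute (conj (u ⁻¹) x) d
  commute-conj u x d c = begin
    conj (u ⁻¹) x ∙ d                       ≈⟨ ∙-congˡ (conj-inverse u d) ⟨
    conj (u ⁻¹) x ∙ conj (u ⁻¹) (conj u d)  ≈⟨ conj-commute (u ⁻¹) c ⟩
    conj (u ⁻¹) (conj u d) ∙ conj (u ⁻¹) x  ≈⟨ ∙-congʳ (conj-inverse u d) ⟩
    d ∙ conj (u ⁻¹) x                       ∎

  commutator-injective : ∀ x z z' → commutator x z ≈ commutator x z' → Commute (z' ⁻¹ ∙ z) x
  commutator-injective x z z' e = commute-sym (commute-inv⁻ (commute-sym (fixed⇒commute (begin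
    conj (z' ⁻¹ ∙ z) (x ⁻¹)          ≈⟨ conj-∙ (z' ⁻¹) z (x ⁻¹) ⟨
    conj (z' ⁻¹) (conj z (x ⁻¹))     ≈⟨ conj-cong (z' ⁻¹) conj-equal ⟩
    conj (z' ⁻¹) (conj z' (x ⁻¹))    ≈⟨ conj-inverse z' (x ⁻¹) ⟩
    x ⁻¹                             ∎))))
    where
    as-conj : ∀ z → commutator x z ≈ x ∙ conj z (x ⁻¹)
    as-conj z = begin
      ((x ∙ z) ∙ x ⁻¹) ∙ z ⁻¹   ≈⟨ ∙-congʳ (assoc x z (x ⁻¹)) ⟩
      (x ∙ (z ∙ x ⁻¹)) ∙ z ⁻¹   ≈⟨ assoc x (z ∙ x ⁻¹) (z ⁻¹) ⟩
      x ∙ conj z (x ⁻¹)         ∎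
    conj-equal : conj z (x ⁻¹) ≈ conj z' (x ⁻¹)
    conj-equal = ∙-cancelˡ x _ _ (≈-trans (≈-sym (as-conj z)) (≈-trans e (as-conj z')))
    fixed⇒commute : ∀ {w a} → conj w a ≈ a → Commute w a
    fixed⇒commute {w} {a} f = begin
      w ∙ a                  ≈⟨ //-rightDividesˡ w (w ∙ a) ⟨
      ((w ∙ a) ∙ w ⁻¹) ∙ w   ≈⟨ ∙-congʳ f ⟩
      a ∙ w                  ∎

module _ {A : Set} where

  infix 4 _⇄_

  _⇄_ : List A → List A → Set
  x ⇄ y = x ++ y ≡ y ++ x

  _^_ : List A → ℕ → List A
  c ^ zero = []
  c ^ suc n = c ++ c ^ n

  length-^ : ∀ (c : List A) n → length (c ^ n) ≡ n * length c
  length-^ c zero = refl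
  length-^ c (suc n) = trans (length-++ c) (cong (λ m → length c + m) (length-^ c n))

  ^-long : ∀ (c : List A) n → c ≢ [] → n ≤ length (c ^ n)
  ^-long [] n ne = ⊥-elim (ne refl)
  ^-long (a ∷ c) n _ = ≤-trans (m≤m*n n (length (a ∷ c))) (≤-reflexive (sym (length-^ (a ∷ c) n)))

  private
    take-++ˡ : ∀ n (xs ys : List A) → n ≤ length xs → take n (xs ++ ys) ≡ take n xs
    take-++ˡ zero xs ys _ = refl
    take-++ˡ (suc n) (x ∷ xs) ys (s≤s le) = cong (x ∷_) (take-++ˡ n xs ys le)

    take-length-++ : ∀ (xs ys : List A) → take (length xs) (xs ++ ys) ≡ xs
    take-length-++ [] ys = refl
    take-length-++ (x ∷ xs) ys = cong (x ∷_) (take-length-++ xs ys)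

  ⇄-prefix : ∀ (x C : List A) → x ⇄ C → length x ≤ length C → x ≡ take (length x) C
  ⇄-prefix x C e le =
    trans (sym (take-length-++ x C)) (trans (cong (take (length x)) e) (take-++ˡ (length x) C x le))

  ⇄-++ : ∀ (x y C : List A) → x ⇄ C → y ⇄ C → x ++ y ⇄ C
  ⇄-++ x y C ex ey = begin
    (x ++ y) ++ C  ≡⟨ ++-assoc x y C ⟩
    x ++ (y ++ C)  ≡⟨ cong (x ++_) ey ⟩
    x ++ (C ++ y)  ≡⟨ sym (++-assoc x C y) ⟩
    (x ++ C) ++ y  ≡⟨ cong (_++ y) ex ⟩
    (C ++ x) ++ y  ≡⟨ ++-assoc C x y ⟩
    C ++ (x ++ y)  ∎
    where open ≡-Reasoning

  ⇄-^ : ∀ (x c : List A) n → x ⇄ c → x ⇄ c ^ n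
  ⇄-^ x c zero e = ++-identityʳ x
  ⇄-^ x c (suc n) e = sym (⇄-++ c (c ^ n) x (sym e) (sym (⇄-^ x c n e)))

  periodic : List A → ℕ → List A
  periodic c ℓ = take ℓ (c ^ ℓ)

  length-periodic : ∀ (c : List A) ℓ → c ≢ [] → length (periodic c ℓ) ≡ ℓ
  length-periodic c ℓ ne = trans (length-take ℓ (c ^ ℓ)) (m≤n⇒m⊓n≡m (^-long c ℓ ne))

  ⇄-periodic : ∀ (x c : List A) → c ≢ [] → x ⇄ c → x ≡ periodic c (length x)
  ⇄-periodic x c ne e = ⇄-prefix x (c ^ length x) (⇄-^ x c (length x) e) (^-long c (length x) ne)

  -- String commutation is transitive through a nonempty word: both x y and y x
  -- are the prefix of the same length of a long power of C.
  ⇄-trans : ∀ (C : List A) → C ≢ [] → ∀ x y → x ⇄ C → y ⇄ C → x ⇄ y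
  ⇄-trans C ne x y xC yC = begin
    x ++ y                        ≡⟨ ⇄-periodic (x ++ y) C ne (⇄-++ x y C xC yC) ⟩
    periodic C (length (x ++ y))  ≡⟨ cong (periodic C) length-swap ⟩
    periodic C (length (y ++ x))  ≡⟨ sym (⇄-periodic (y ++ x) C ne (⇄-++ y x C yC xC)) ⟩
    y ++ x                        ∎
    where
    open ≡-Reasoning
    length-swap : length (x ++ y) ≡ length (y ++ x)
    length-swap = trans (length-++ x) (trans (+-comm (length x) (length y)) (sym (length-++ y)))

  ⇄-first : ∀ {x y : List A} {q r} → x ⇄ y → StartsWith x q → StartsWith y r → q ≡ r
  ⇄-first e (x' , refl) (y' , refl) = ∷-injectiveˡ e

  ⇄-last : ∀ {x y : List A} {p l} → x ⇄ y → EndsWith x p → EndsWith y l → p ≡ l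
  ⇄-last {p = p} {l} e (x' , refl) (y' , refl) = sym (∷ʳ-injectiveʳ ((x' ∷ʳ p) ++ y') ((y' ∷ʳ l) ++ x')
    (trans (++-assoc (x' ∷ʳ p) y' [ l ]) (trans e (sym (++-assoc (y' ∷ʳ l) x' [ p ])))))

  ⇄-singleton : ∀ (s : A) c → c ⇄ [ s ] → c ≡ replicate (length c) s
  ⇄-singleton s [] e = refl
  ⇄-singleton s (x ∷ c) e with ∷-injective e
  ... | refl , e' = cong (s ∷_) (⇄-singleton s c e')

  ⇄-consecutive : ∀ (C : List A) → C ≢ [] → ∀ x x' → x ⇄ C → x' ⇄ C
    → length x' ≡ suc (length x) → Σ[ s ∈ A ] C ≡ replicate (length C) s
  ⇄-consecutive C ne x x' xC x'C len with initLast x'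
  ... | [] = ⊥-elim (0≢1+n len)
  ... | ys ∷ʳ′ s = s , ⇄-singleton s C C⇄s
    where
    open ≡-Reasoning
    xx' : x ⇄ ys ∷ʳ s
    xx' = ⇄-trans C ne x (ys ∷ʳ s) xC x'C
    length-ys : length ys ≡ length x
    length-ys = suc-injective (trans (trans (+-comm 1 (length ys)) (sym (length-++ ys))) len)
    x≡ys : x ≡ ys
    x≡ys = begin
      x                               ≡⟨ ⇄-prefix x (ys ∷ʳ s) xx' (≤-trans (n≤1+n _) (≤-reflexive (sym len))) ⟩
      take (length x) (ys ++ [ s ])   ≡⟨ cong (λ n → take n (ys ++ [ s ])) (sym length-ys) ⟩
      take (length ys) (ys ++ [ s ])  ≡⟨ take-length-++ ys [ s ] ⟩
      ys                              ∎
    x⇄s : x ⇄ [ s ]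
    x⇄s = ++-cancelˡ x (x ++ [ s ]) ([ s ] ++ x) (begin
      x ++ (x ++ [ s ])  ≡⟨ cong (λ z → x ++ (z ++ [ s ])) x≡ys ⟩
      x ++ (ys ++ [ s ]) ≡⟨ xx' ⟩
      (ys ++ [ s ]) ++ x ≡⟨ cong (λ z → (z ++ [ s ]) ++ x) (sym x≡ys) ⟩
      (x ++ [ s ]) ++ x  ≡⟨ ++-assoc x [ s ] x ⟩
      x ++ ([ s ] ++ x)  ∎)
    x'⇄s : ys ∷ʳ s ⇄ [ s ]
    x'⇄s = subst (λ z → z ∷ʳ s ⇄ [ s ]) x≡ys (⇄-++ x [ s ] [ s ] x⇄s refl)
    C⇄s : C ⇄ [ s ]
    C⇄s = ⇄-trans (ys ∷ʳ s) (λ e → case ++-conicalʳ ys [ s ] e of λ ()) C [ s ] (sym x'C) (sym x'⇄s)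

record CyclicDecomposition {k} (g : Word k) : Set where
  field
    u : Word k
    a : Letter k
    c' : Word k
  c : Word k
  c = a ∷ c'
  field
    g≡ucu⁻¹ : g ≡ u ++ c ++ inv u
    cc-reduced : IsReduced (c ++ c)

module _ {k : ℕ} where

  private
    -- Peel off matching outer letters a … a⁻¹ until the first and last letters
    -- do not cancel; 'n' bounds the length of the word.
    decompose : ∀ n (a : Letter k) t → length (a ∷ t) ≤ n → IsReduced (a ∷ t)
      → CyclicDecomposition (a ∷ t)
    decompose (suc n) a t (s≤s le) r = go (initLast t) le r
      where
      go : ∀ {t} → InitLast t → length t ≤ n → IsReduced (a ∷ t)
        → CyclicDecomposition (a ∷ t)
      go [] _ _ = record { u = [] ; a = a ; c' = [] ; g≡ucu⁻¹ = refl
                         ; cc-reduced = reduced-cons a a [] tt (cancels-self a) }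
      go (m ∷ʳ′ b) le r with cancels b a in e
      ... | false = record
        { u = [] ; a = a ; c' = m ++ [ b ] ; g≡ucu⁻¹ = sym (++-identityʳ _)
        ; cc-reduced = ++-reduced (a ∷ m ++ [ b ]) (a ∷ m ++ [ b ]) r r
                         (boundary-compatible (a ∷ m , refl) (m ++ [ b ] , refl) e)
        }
      go ([] ∷ʳ′ b) le r | true =
        ⊥-elim (true≢false (trans (sym (cancels-sym b a e)) (reduced-head a b [] r)))
      go ((m₀ ∷ ms) ∷ʳ′ b) le r | true = record
        { u = a ∷ D.u ; a = D.a ; c' = D.c' ; g≡ucu⁻¹ = cong (a ∷_) m≡ ; cc-reduced = D.cc-reduced }
        where
        m : Word k
        m = m₀ ∷ ms
        D : CyclicDecomposition m
        D = decompose n m₀ ms (≤-trans (length-++-≤ˡ m) le)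
              (reduced-prefix m [ b ] (reduced-tail a (m ++ [ b ]) r))
        module D = CyclicDecomposition D
        b≡a⁻¹ : b ≡ invL a
        b≡a⁻¹ = trans (sym (invL-involutive b)) (cong invL (sym (cancels⇒invL b a e)))
        m≡ : m ++ [ b ] ≡ (D.u ++ D.c ++ inv (a ∷ D.u))
        m≡ = begin
          m ++ [ b ]                          ≡⟨ cong (_++ [ b ]) D.g≡ucu⁻¹ ⟩
          (D.u ++ D.c ++ inv D.u) ++ [ b ]    ≡⟨ ++-assoc D.u (D.c ++ inv D.u) [ b ] ⟩
          D.u ++ (D.c ++ inv D.u) ++ [ b ]    ≡⟨ cong (D.u ++_) (++-assoc D.c (inv D.u) [ b ]) ⟩
          D.u ++ D.c ++ inv D.u ++ [ b ]      ≡⟨ cong (λ z → D.u ++ D.c ++ inv D.u ++ [ z ]) b≡a⁻¹ ⟩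
          D.u ++ D.c ++ inv D.u ++ [ invL a ] ≡⟨ cong (λ z → D.u ++ D.c ++ z) (sym (inv-cons a D.u)) ⟩
          D.u ++ D.c ++ inv (a ∷ D.u)         ∎
          where open ≡-Reasoning

  cyclic-decomposition : ∀ (g : Word k) → IsReduced g → g ≢ [] → CyclicDecomposition g
  cyclic-decomposition [] _ ne = ⊥-elim (ne refl)
  cyclic-decomposition (a ∷ t) r _ = decompose (length (a ∷ t)) a t ≤-refl r

module _ {k : ℕ} where

  open GroupLemmas (FreeGroup k) using (Commute; commute-sym; commute-inv)

  -- If w and v commute in F_k and v w is reduced, then so is w v: it has the
  -- same length as the common normal form.
  commute-reduced : ∀ (w v : Word k) → Commute w v → IsReduced (v ++ w) → IsReduced (w ++ v)
  commute-reduced w v e r = reduced-if-not-shorter (w ++ v) (≤-reflexive (begin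
    length (w ++ v)           ≡⟨ List.length-++-comm w v ⟩
    length (v ++ w)           ≡⟨ cong length (sym (reduce-fixes (v ++ w) r)) ⟩
    length (reduce (v ++ w))  ≡⟨ cong length (sym e) ⟩
    length (reduce (w ++ v))  ∎))
    where open ≡-Reasoning

  commute⇒⇄ : ∀ (w v : Word k) → Commute w v → IsReduced (w ++ v) → w ⇄ v
  commute⇒⇄ w v e r = reduced-unique (w ++ v) (v ++ w) r (commute-reduced v w (commute-sym {w} {v} e) r) e

  -- A reduced word y commuting with a cyclically reduced word c commutes with c
  -- as a string, up to inversion: if the last letter of y does not cancel the
  -- first letter of c then y c is reduced, otherwise c y⁻¹ is.
  commute-cyclic : ∀ a c' (y : Word k) → IsReduced ((a ∷ c') ++ (a ∷ c')) → IsReduced y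
    → Commute y (a ∷ c') → y ⇄ a ∷ c' ⊎ inv y ⇄ a ∷ c'
  commute-cyclic a c' y rcc ry yc = by-last-letter (initLast y) ry yc
    where
    c : Word k
    c = a ∷ c'
    rc : IsReduced c
    rc = reduced-prefix c c rcc
    c-ends : EndsWith c (proj₁ (last-of a c'))
    c-ends = proj₂ (last-of a c')
    by-last-letter : ∀ {y} → InitLast y → IsReduced y → Commute y c → y ⇄ c ⊎ inv y ⇄ c
    by-last-letter [] _ _ = inj₁ (sym (++-identityʳ c))
    by-last-letter (ys ∷ʳ′ p) ry yc with cancels p a in pa
    ... | false = inj₁ (commute⇒⇄ (ys ∷ʳ p) c yc
      (++-reduced (ys ∷ʳ p) c ry rc (boundary-compatible (ys , refl) (c' , refl) pa)))
    ... | true = inj₂ (commute⇒⇄ (inv (ys ∷ʳ p)) c y⁻¹c (commute-reduced (inv (ys ∷ʳ p)) c y⁻¹c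
      (++-reduced c (inv (ys ∷ʳ p)) rc (inv-reduced (ys ∷ʳ p) ry) c-y⁻¹)))
      where
      y⁻¹c : Commute (inv (ys ∷ʳ p)) c
      y⁻¹c = commute-inv {ys ∷ʳ p} {c} yc
      -- y ends with a⁻¹, so y⁻¹ begins with a, which the last letter of c does not cancel.
      y⁻¹-starts : StartsWith (inv (ys ∷ʳ p)) a
      y⁻¹-starts = inv ys , trans (inv-snoc ys p) (cong (_∷ inv ys) (sym (cancels⇒invL p a pa)))
      c-y⁻¹ : Compatible c (inv (ys ∷ʳ p))
      c-y⁻¹ = boundary-compatible c-ends y⁻¹-starts (reduced-++⇒compatible c c rcc c-ends (c' , refl))

signed : ∀ {k} → Bool → Word k → Word k
signed true s = s
signed false s = inv s

length-signed : ∀ {k} b (s : Word k) → length (signed b s) ≡ length s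
length-signed true s = refl
length-signed false s = length-inv s

module Centralizer {k : ℕ} {g : Word k} (rg : IsReduced g) (D : CyclicDecomposition g) where

  open CyclicDecomposition D
  open GroupLemmas (FreeGroup k)

  private
    rucu : IsReduced (u ++ c ++ inv u)
    rucu = subst IsReduced g≡ucu⁻¹ rg
    ru : IsReduced u
    ru = reduced-prefix u (c ++ inv u) rucu
    ru⁻¹ : IsReduced (inv u)
    ru⁻¹ = inv-reduced u ru
    u-c : Compatible u c
    u-c ue cs = reduced-++⇒compatible u (c ++ inv u) rucu ue (starts-++ (inv u) cs)
    c-u⁻¹ : Compatible c (inv u)
    c-u⁻¹ ce = reduced-++⇒compatible (u ++ c) (inv u)
      (subst IsReduced (sym (++-assoc u c (inv u))) rucu) (ends-++ u ce)
    c-ends : EndsWith c (proj₁ (last-of a c'))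
    c-ends = proj₂ (last-of a c')

    -- A nonempty reduced word commuting with c as a string begins and ends like c,
    -- so conjugating it by u causes no cancellation.
    sandwich-reduced : ∀ s → s ≢ [] → IsReduced s → s ⇄ c → IsReduced (u ++ s ++ inv u)
    sandwich-reduced [] ne _ _ = ⊥-elim (ne refl)
    sandwich-reduced (q ∷ t) _ rs sc =
      ++-reduced u (s ++ inv u) ru (++-reduced s (inv u) rs ru⁻¹ s-u⁻¹) u-s
      where
      s : Word k
      s = q ∷ t
      u-s : Compatible u (s ++ inv u)
      u-s {q = q'} ue (v' , e) = u-c ue (c' , cong (_∷ c') (sym q'≡a))
        where
        q'≡a : q' ≡ a
        q'≡a = trans (∷-injectiveˡ (sym e)) (⇄-first sc (t , refl) (c' , refl))
      s-u⁻¹ : Compatible s (inv u)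
      s-u⁻¹ se = c-u⁻¹ (subst (EndsWith c) (sym (⇄-last sc se c-ends)) c-ends)

    inv-sandwich : ∀ s → inv (u ++ s ++ inv u) ≡ u ++ inv s ++ inv u
    inv-sandwich s = begin
      inv (u ++ s ++ inv u)            ≡⟨ inv-++ u (s ++ inv u) ⟩
      inv (s ++ inv u) ++ inv u        ≡⟨ cong (_++ inv u) (inv-++ s (inv u)) ⟩
      (inv (inv u) ++ inv s) ++ inv u  ≡⟨ cong (λ z → (z ++ inv s) ++ inv u) (inv-involutive u) ⟩
      (u ++ inv s) ++ inv u            ≡⟨ ++-assoc u (inv s) (inv u) ⟩
      u ++ inv s ++ inv u              ∎
      where open ≡-Reasoning

    signed-sandwich-reduced : ∀ b s → s ≢ [] → IsReduced s → s ⇄ c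
      → IsReduced (u ++ signed b s ++ inv u)
    signed-sandwich-reduced true s ne rs sc = sandwich-reduced s ne rs sc
    signed-sandwich-reduced false s ne rs sc =
      subst IsReduced (inv-sandwich s) (inv-reduced (u ++ s ++ inv u) (sandwich-reduced s ne rs sc))

  Sandwiched : Word k → Set
  Sandwiched h = Σ[ b ∈ Bool ] Σ[ s ∈ Word k ] (s ≢ [] × s ⇄ c × h ≡ u ++ signed b s ++ inv u)

  -- Every reduced word commuting with g = u c u⁻¹ is trivial or sandwiched.
  -- (Conjugating by u⁻¹ gives a word commuting with c; 'commute-cyclic' and the
  -- absence of cancellation in the sandwich do the rest.)
  centralizer-word : ∀ h → IsReduced h → Commute h g
    → h ≡ [] ⊎ Sandwiched h
  centralizer-word h rh hg =
    split h' refl (commute-cyclic a c' h' cc-reduced (reduce-reduced (conj (inv u) h)) h'c)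
    where
    h' : Word k
    h' = reduce (conj (inv u) h)
    h'≈ : reduce h' ≡ reduce (conj (inv u) h)
    h'≈ = reduce-idempotent (conj (inv u) h)
    h'c : Commute h' c
    h'c = commute-resp {conj (inv u) h} {h'} {c} {c} (sym h'≈) refl
      (commute-conj u h c (commute-resp {h} {h} {g} refl
        (cong reduce (trans g≡ucu⁻¹ (sym (++-assoc u c (inv u))))) hg))
    h≈ : reduce h ≡ reduce (u ++ h' ++ inv u)
    h≈ = begin
      reduce h                          ≡⟨ sym (subst (λ v → reduce (conj v (conj (inv u) h)) ≡ reduce h)
                                             (inv-involutive u) (conj-inverse (inv u) h)) ⟩
      reduce (conj u (conj (inv u) h))  ≡⟨ conj-cong u {conj (inv u) h} {h'} (sym h'≈) ⟩
      reduce (conj u h')                ≡⟨ cong reduce (++-assoc u h' (inv u)) ⟩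
      reduce (u ++ h' ++ inv u)         ∎
      where open ≡-Reasoning
    sandwich : ∀ b s → s ≢ [] → IsReduced s → s ⇄ c → h' ≡ signed b s
      → h ≡ [] ⊎ Sandwiched h
    sandwich b s ne rs sc e = inj₂ (b , s , ne , sc ,
      reduced-unique h _ rh (signed-sandwich-reduced b s ne rs sc)
        (trans h≈ (cong (λ z → reduce (u ++ z ++ inv u)) e)))
    split : ∀ w → w ≡ h' → w ⇄ c ⊎ inv w ⇄ c
      → h ≡ [] ⊎ Sandwiched h
    split [] e _ = inj₁ (reduced-unique h [] rh tt
      (trans h≈ (trans (cong (λ z → reduce (u ++ z ++ inv u)) (sym e)) (reduce-++-inv u))))
    split (q ∷ t) e (inj₁ sc) =
      sandwich true (q ∷ t) (λ ()) (subst IsReduced (sym e) (reduce-reduced (conj (inv u) h))) sc (sym e)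
    split (q ∷ t) e (inj₂ sc) =
      sandwich false (inv (q ∷ t)) ne
        (inv-reduced (q ∷ t) (subst IsReduced (sym e) (reduce-reduced (conj (inv u) h))))
        sc (trans (sym e) (sym (inv-involutive (q ∷ t))))
      where
      ne : inv (q ∷ t) ≢ []
      ne e' = 0≢1+n (trans (cong length (sym e')) (length-inv (q ∷ t)))

  private
    commute-signed : ∀ b b' (s s' : Word k) → Commute s s' → Commute (signed b s) (signed b' s')
    commute-signed true true s s' cs = cs
    commute-signed false true s s' cs = commute-inv {s} {s'} cs
    commute-signed true false s s' cs =
      commute-sym {inv s'} {s} (commute-inv {s'} {s} (commute-sym {s} {s'} cs))
    commute-signed false false s s' cs = commute-sym {inv s'} {inv s}
      (commute-inv {s'} {inv s} (commute-sym {inv s} {s'} (commute-inv {s} {s'} cs)))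

  -- The centralizer of a nontrivial element is commutative: all its elements are
  -- conjugates by u of powers of words commuting with c as strings.
  centralizer-commutative : ∀ x y → IsReduced x → IsReduced y → Commute x g → Commute y g
    → Commute x y
  centralizer-commutative x y rx ry xg yg =
    from-forms (centralizer-word x rx xg) (centralizer-word y ry yg)
    where
    from-forms : x ≡ [] ⊎ Sandwiched x → y ≡ [] ⊎ Sandwiched y → Commute x y
    from-forms (inj₁ x≡[]) _ =
      subst (λ z → Commute z y) (sym x≡[]) (cong reduce (sym (++-identityʳ y)))
    from-forms (inj₂ _) (inj₁ y≡[]) =
      subst (λ z → Commute x z) (sym y≡[]) (cong reduce (++-identityʳ x))
    from-forms (inj₂ (b , s , _ , sc , x≡)) (inj₂ (b' , s' , _ , s'c , y≡)) =
      commute-resp {conj u X} {x} {conj u Y} {y} (as-conj X x≡) (as-conj Y y≡)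
        (conj-commute u {X} {Y} (commute-signed b b' s s' (cong reduce (⇄-trans c (λ ()) s s' sc s'c))))
      where
      X Y : Word k
      X = signed b s
      Y = signed b' s'
      as-conj : ∀ z {h} → h ≡ u ++ z ++ inv u → reduce (conj u z) ≡ reduce h
      as-conj z e = cong reduce (trans (++-assoc u z (inv u)) (sym e))

  power : ℕ → Bool → Word k
  power ℓ b = u ++ signed b (periodic c ℓ) ++ inv u

  record CentralizerForm (h : Word k) : Set where
    field
      ℓ : ℕ
      sign : Bool
      1≤ℓ : 1 ≤ ℓ
      ℓ≤|h| : ℓ ≤ length h
      periodic⇄c : periodic c ℓ ⇄ c
      h≡power : h ≡ power ℓ sign

  centralizer : ∀ h → IsReduced h → Commute h g → h ≡ [] ⊎ CentralizerForm h
  centralizer h rh hg = Sum.map₂ form (centralizer-word h rh hg)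
    where
    form : Sandwiched h → CentralizerForm h
    form (b , s , ne , sc , e) = record
      { ℓ = length s
      ; sign = b
      ; 1≤ℓ = nonempty-length s ne
      ; ℓ≤|h| = begin
          length s                           ≡⟨ sym (length-signed b s) ⟩
          length (signed b s)                ≤⟨ length-++-≤ˡ (signed b s) ⟩
          length (signed b s ++ inv u)       ≤⟨ length-++-≤ʳ (signed b s ++ inv u) {u} ⟩
          length (u ++ signed b s ++ inv u)  ≡⟨ cong length (sym e) ⟩
          length h                           ∎
      ; periodic⇄c = subst (_⇄ c) s≡ sc
      ; h≡power = trans e (cong (λ z → u ++ signed b z ++ inv u) s≡)
      }
      where
      open ≤-Reasoning
      s≡ : s ≡ periodic c (length s)
      s≡ = ⇄-periodic s c (λ ()) sc
      nonempty-length : ∀ (s : Word k) → s ≢ [] → 1 ≤ length s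
      nonempty-length [] ne = ⊥-elim (ne refl)
      nonempty-length (_ ∷ _) _ = s≤s z≤n

-- The exponent sum of a generator a_i is a homomorphism
-- F_k → ℤ; it vanishes on commutators and is invariant under conjugation, but
-- it is nonzero on nontrivial powers of a_i^{±1}.

module _ {k : ℕ} where

  letter-exp : Fin k → Letter k → ℤ
  letter-exp i (j , b) = if ⌊ j Fin.≟ i ⌋ then (if b then + 1 else - + 1) else + 0

  exp-sum : Fin k → Word k → ℤ
  exp-sum i [] = + 0
  exp-sum i (x ∷ w) = letter-exp i x ⊕ exp-sum i w

  letter-exp-invL : ∀ i p → letter-exp i (invL p) ≡ - letter-exp i p
  letter-exp-invL i (j , b) with j Fin.≟ i | b
  ... | no _ | _ = refl
  ... | yes _ | true = refl
  ... | yes _ | false = refl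

  exp-sum-++ : ∀ i (u v : Word k) → exp-sum i (u ++ v) ≡ exp-sum i u ⊕ exp-sum i v
  exp-sum-++ i [] v = sym (ℤ.+-identityˡ (exp-sum i v))
  exp-sum-++ i (x ∷ u) v = trans (cong (letter-exp i x ⊕_) (exp-sum-++ i u v))
    (sym (ℤ.+-assoc (letter-exp i x) (exp-sum i u) (exp-sum i v)))

  exp-sum-push : ∀ i a (w : Word k) → exp-sum i (push a w) ≡ letter-exp i a ⊕ exp-sum i w
  exp-sum-push i a [] = refl
  exp-sum-push i a (b ∷ w) with cancels a b in e
  ... | false = refl
  ... | true rewrite cancels⇒invL a b e | letter-exp-invL i a = cancel (letter-exp i a) (exp-sum i w)
    where
    cancel : ∀ m n → n ≡ m ⊕ (- m ⊕ n)
    cancel = solve-∀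

  exp-sum-reduce : ∀ i (w : Word k) → exp-sum i (reduce w) ≡ exp-sum i w
  exp-sum-reduce i [] = refl
  exp-sum-reduce i (x ∷ w) =
    trans (exp-sum-push i x (reduce w)) (cong (letter-exp i x ⊕_) (exp-sum-reduce i w))

  exp-sum-inv : ∀ i (x : Word k) → exp-sum i (inv x) ≡ - exp-sum i x
  exp-sum-inv i [] = refl
  exp-sum-inv i (a ∷ x) = begin
    exp-sum i (inv (a ∷ x))                               ≡⟨ cong (exp-sum i) (inv-cons a x) ⟩
    exp-sum i (inv x ++ [ invL a ])                       ≡⟨ exp-sum-++ i (inv x) [ invL a ] ⟩
    exp-sum i (inv x) ⊕ (letter-exp i (invL a) ⊕ + 0) ≡⟨ cong₂ (λ m n → m ⊕ (n ⊕ + 0)) (exp-sum-inv i x) (letter-exp-invL i a) ⟩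
    - exp-sum i x ⊕ (- letter-exp i a ⊕ + 0)          ≡⟨ negate (letter-exp i a) (exp-sum i x) ⟩
    - (letter-exp i a ⊕ exp-sum i x)                    ∎
    where
    open ≡-Reasoning
    negate : ∀ m n → - n ⊕ (- m ⊕ + 0) ≡ - (m ⊕ n)
    negate = solve-∀

  exp-sum-commutator : ∀ i (x y : Word k) → exp-sum i ⟦ x , y ⟧ ≡ + 0
  exp-sum-commutator i x y = begin
    exp-sum i ⟦ x , y ⟧                                    ≡⟨ cong (exp-sum i) (⟦⟧-as-reduce x y) ⟩
    exp-sum i (reduce (((x ++ y) ++ inv x) ++ inv y))      ≡⟨ exp-sum-reduce i (((x ++ y) ++ inv x) ++ inv y) ⟩
    exp-sum i (((x ++ y) ++ inv x) ++ inv y)               ≡⟨ exp-sum-++ i ((x ++ y) ++ inv x) (inv y) ⟩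
    exp-sum i ((x ++ y) ++ inv x) ⊕ exp-sum i (inv y)    ≡⟨ cong₂ _⊕_ (exp-sum-++ i (x ++ y) (inv x)) (exp-sum-inv i y) ⟩
    (exp-sum i (x ++ y) ⊕ exp-sum i (inv x)) ⊕ - Y     ≡⟨ cong₂ (λ m n → (m ⊕ n) ⊕ - Y) (exp-sum-++ i x y) (exp-sum-inv i x) ⟩
    ((X ⊕ Y) ⊕ - X) ⊕ - Y                            ≡⟨ vanish X Y ⟩
    + 0                                                    ∎
    where
    open ≡-Reasoning
    X Y : ℤ
    X = exp-sum i x
    Y = exp-sum i y
    vanish : ∀ m n → ((m ⊕ n) ⊕ - m) ⊕ - n ≡ + 0
    vanish = solve-∀

  exp-sum-conj : ∀ i (u c : Word k) → exp-sum i (u ++ c ++ inv u) ≡ exp-sum i c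
  exp-sum-conj i u c = begin
    exp-sum i (u ++ c ++ inv u)                           ≡⟨ exp-sum-++ i u (c ++ inv u) ⟩
    exp-sum i u ⊕ exp-sum i (c ++ inv u)                ≡⟨ cong (exp-sum i u ⊕_) (exp-sum-++ i c (inv u)) ⟩
    exp-sum i u ⊕ (exp-sum i c ⊕ exp-sum i (inv u))   ≡⟨ cong (λ z → exp-sum i u ⊕ (exp-sum i c ⊕ z)) (exp-sum-inv i u) ⟩
    exp-sum i u ⊕ (exp-sum i c ⊕ - exp-sum i u)       ≡⟨ cancel (exp-sum i u) (exp-sum i c) ⟩
    exp-sum i c                                           ∎
    where
    open ≡-Reasoning
    cancel : ∀ m n → m ⊕ (n ⊕ - m) ≡ n
    cancel = solve-∀

  private
    letter-exp-self : ∀ i b → letter-exp i (i , b) ≡ (if b then + 1 else - + 1)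
    letter-exp-self i b with i Fin.≟ i
    ... | yes _ = refl
    ... | no i≢i = ⊥-elim (i≢i refl)

    exp-sum-positive : ∀ i n → exp-sum i (replicate n (i , true)) ≡ + n
    exp-sum-positive i zero = refl
    exp-sum-positive i (suc n) = cong₂ _⊕_ (letter-exp-self i true) (exp-sum-positive i n)

    exp-sum-negative : ∀ i n → exp-sum i (replicate (suc n) (i , false)) ≡ -[1+ n ]
    exp-sum-negative i zero = cong (_⊕ + 0) (letter-exp-self i false)
    exp-sum-negative i (suc n) = cong₂ _⊕_ (letter-exp-self i false) (exp-sum-negative i n)

  exp-sum-power : ∀ i b n → exp-sum i (replicate (suc n) (i , b)) ≢ + 0
  exp-sum-power i true n e with trans (sym (exp-sum-positive i (suc n))) e
  ... | ()
  exp-sum-power i false n e with trans (sym (exp-sum-negative i n)) e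
  ... | ()

module _ {A B : Set} where

  private
    remove : ∀ {y w : B} ys zs → y ∈ (ys ++ w ∷ zs) → y ≢ w → y ∈ (ys ++ zs)
    remove [] zs (here e) ne = ⊥-elim (ne e)
    remove [] zs (there p) ne = p
    remove (z ∷ ys) zs (here e) ne = here e
    remove (z ∷ ys) zs (there p) ne = there (remove ys zs p ne)

  length-≤-injection : ∀ (f : A → B) (xs : List A) (ys : List B) → Unique xs
    → (∀ {x y} → x ∈ xs → y ∈ xs → f x ≡ f y → x ≡ y)
    → (∀ {x} → x ∈ xs → f x ∈ ys)
    → length xs ≤ length ys
  length-≤-injection f [] ys _ _ _ = z≤n
  length-≤-injection f (x ∷ xs) ys (x∉xs ∷ uxs) inj into with ∈-∃++ (into (here refl))
  ... | ys₁ , ys₂ , refl = begin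
    suc (length xs)                  ≤⟨ s≤s (length-≤-injection f xs (ys₁ ++ ys₂) uxs
                                           (λ p q → inj (there p) (there q)) into') ⟩
    suc (length (ys₁ ++ ys₂))        ≡⟨ cong suc (length-++ ys₁) ⟩
    suc (length ys₁ + length ys₂)    ≡⟨ sym (+-suc (length ys₁) (length ys₂)) ⟩
    length ys₁ + length (f x ∷ ys₂)  ≡⟨ sym (length-++ ys₁) ⟩
    length (ys₁ ++ [ f x ] ++ ys₂)   ∎
    where
    open ≤-Reasoning
    -- The remaining elements avoid f x, so they map into ys with f x removed.
    into' : ∀ {y} → y ∈ xs → f y ∈ (ys₁ ++ ys₂)
    into' p = remove ys₁ ys₂ (into (there p))
      (λ e → All.lookup x∉xs p (inj (here refl) (there p) (sym e)))

length-cartesianProduct : ∀ {A B : Set} (xs : List A) (ys : List B)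
  → length (cartesianProduct xs ys) ≡ length xs * length ys
length-cartesianProduct [] ys = refl
length-cartesianProduct (x ∷ xs) ys = trans (length-++ (map (x ,_) ys))
  (cong₂ _+_ (length-map (x ,_) ys) (length-cartesianProduct xs ys))

enumerate : ∀ {X : Set} → (ℕ → Bool → X) → ℕ → List X
enumerate f zero = []
enumerate f (suc n) = f n true ∷ f n false ∷ enumerate f n

length-enumerate : ∀ {X : Set} (f : ℕ → Bool → X) n → length (enumerate f n) ≡ n + n
length-enumerate f zero = refl
length-enumerate f (suc n) = cong suc (trans (cong suc (length-enumerate f n)) (sym (+-suc n n)))

∈-enumerate : ∀ {X : Set} (f : ℕ → Bool → X) n q b → q < n → f q b ∈ enumerate f n
∈-enumerate f (suc n) q b (s≤s q≤n) with m≤n⇒m<n∨m≡n q≤n | b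
... | inj₂ refl | true = here refl
... | inj₂ refl | false = there (here refl)
... | inj₁ q<n | b' = there (there (∈-enumerate f n q b' q<n))

parity : ∀ ℓ → Σ[ q ∈ ℕ ] (ℓ ≡ q + q ⊎ ℓ ≡ suc (q + q))
parity zero = 0 , inj₁ refl
parity (suc zero) = 0 , inj₂ refl
parity (suc (suc ℓ)) with parity ℓ
... | q , inj₁ e = suc q , inj₁ (cong suc (trans (cong suc e) (sym (+-suc q q))))
... | q , inj₂ e = suc q , inj₂ (cong suc (trans (cong suc e) (cong suc (sym (+-suc q q)))))

half-< : ∀ q n → suc (q + q) ≤ n + n → q < n
half-< q n le with q <? n
... | yes q<n = q<n
... | no q≮n = ⊥-elim (<-irrefl refl (≤-trans le (+-mono-≤ (≮⇒≥ q≮n) (≮⇒≥ q≮n))))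

module CentralizerBalls {k : ℕ} {g : Word k} (rg : IsReduced g) (D : CyclicDecomposition g) where

  open CyclicDecomposition D
  open Centralizer rg D
  open GroupLemmas (FreeGroup k) using (Commute)

  ball : ℕ → List (Word k)
  ball n = [] ∷ enumerate (λ q → power (suc q)) n

  length-ball : ∀ n → length (ball n) ≡ suc (n + n)
  length-ball n = cong suc (length-enumerate _ n)

  ∈-ball : ∀ n h → IsReduced h → Commute h g → length h ≤ n → h ∈ ball n
  ∈-ball n h rh hg le = from-form (centralizer h rh hg)
    where
    from-form : h ≡ [] ⊎ CentralizerForm h → h ∈ ball n
    from-form (inj₁ h≡[]) = here h≡[]
    from-form (inj₂ F) = there (subst (_∈ _) (sym h≡power) (member ℓ 1≤ℓ (≤-trans ℓ≤|h| le)))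
      where
      open CentralizerForm F
      member : ∀ ℓ → 1 ≤ ℓ → ℓ ≤ n → power ℓ sign ∈ enumerate (λ q → power (suc q)) n
      member (suc q) _ q<n = ∈-enumerate _ n q sign q<n

  -- When g has zero exponent sums (e.g. g is a commutator), only every other
  -- length occurs in the centralizer, which halves the count.
  module Balanced (balanced : ∀ i → exp-sum i g ≡ + 0) where

    -- No two words of consecutive lengths commute with c as strings: otherwise c
    -- would be a power of a single letter a_i^{±1}, with nonzero exponent sum in a_i.
    no-consecutive : ∀ x x' → x ⇄ c → x' ⇄ c → length x' ≡ suc (length x) → ⊥
    no-consecutive x x' xc x'c len with ⇄-consecutive c (λ ()) x x' xc x'c len
    ... | (i , b) , c≡ = exp-sum-power i b (length c') (begin
      exp-sum i (replicate (length c) (i , b)) ≡⟨ cong (exp-sum i) (sym c≡) ⟩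
      exp-sum i c                              ≡⟨ sym (exp-sum-conj i u c) ⟩
      exp-sum i (u ++ c ++ inv u)              ≡⟨ cong (exp-sum i) (sym g≡ucu⁻¹) ⟩
      exp-sum i g                              ≡⟨ balanced i ⟩
      + 0                                      ∎)
      where open ≡-Reasoning

    -- Of the lengths 2q+1 and 2q+2, at most one is the length of a periodic prefix
    -- commuting with c; 'pick q' is that one (or 2q+2 if neither is).
    pick : ℕ → ℕ
    pick q with periodic c (suc (q + q)) ++ c ≟W c ++ periodic c (suc (q + q))
    ... | yes _ = suc (q + q)
    ... | no _ = suc (suc (q + q))

    pick-correct : ∀ q ℓ → periodic c ℓ ⇄ c → ℓ ≡ suc (q + q) ⊎ ℓ ≡ suc (suc (q + q))
      → pick q ≡ ℓ
    pick-correct q ℓ pc par with periodic c (suc (q + q)) ++ c ≟W c ++ periodic c (suc (q + q)) | par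
    ... | yes _ | inj₁ e = sym e
    ... | yes p | inj₂ e = ⊥-elim (no-consecutive _ _ p pc (trans (length-periodic c ℓ (λ ()))
      (trans e (cong suc (sym (length-periodic c (suc (q + q)) (λ ())))))))
    ... | no ¬p | inj₁ e = ⊥-elim (¬p (subst (λ l → periodic c l ⇄ c) e pc))
    ... | no _ | inj₂ e = sym e

    sparse-ball : ℕ → List (Word k)
    sparse-ball n = [] ∷ enumerate (λ q → power (pick q)) n

    length-sparse-ball : ∀ n → length (sparse-ball n) ≡ suc (n + n)
    length-sparse-ball n = cong suc (length-enumerate _ n)

    ∈-sparse-ball : ∀ n h → IsReduced h → Commute h g → length h ≤ n + n → h ∈ sparse-ball n
    ∈-sparse-ball n h rh hg le = from-form (centralizer h rh hg)
      where
      from-form : h ≡ [] ⊎ CentralizerForm h → h ∈ sparse-ball n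
      from-form (inj₁ h≡[]) = here h≡[]
      from-form (inj₂ F) = there (subst (_∈ _) (sym h≡power) (member ℓ 1≤ℓ periodic⇄c (≤-trans ℓ≤|h| le)))
        where
        open CentralizerForm F
        member : ∀ ℓ → 1 ≤ ℓ → periodic c ℓ ⇄ c → ℓ ≤ n + n
          → power ℓ sign ∈ enumerate (λ q → power (pick q)) n
        member (suc ℓ') _ pc le with parity ℓ'
        ... | q , par = subst (λ l → power l sign ∈ enumerate (λ q → power (pick q)) n) (pick-correct q (suc ℓ') pc suc-par)
          (∈-enumerate _ n q sign (half-< q n (≤-trans (s≤s q+q≤ℓ') le)))
          where
          suc-par : suc ℓ' ≡ suc (q + q) ⊎ suc ℓ' ≡ suc (suc (q + q))
          suc-par = Sum.map (cong suc) (cong suc) par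
          q+q≤ℓ' : q + q ≤ ℓ'
          q+q≤ℓ' = Sum.[ ≤-reflexive ∘ sym , (λ e → ≤-trans (n≤1+n _) (≤-reflexive (sym e))) ] par

module _ {k : ℕ} where

  open Group (FreeGroup k) using (_⁻¹)
  open GroupLemmas (FreeGroup k)
  open import Algebra.Properties.Group (FreeGroup k) using (inverseˡ-unique; ⁻¹-injective)

  ⟦⟧≡[]⇒commute : ∀ (x y : Word k) → ⟦ x , y ⟧ ≡ [] → Commute x y
  ⟦⟧≡[]⇒commute x y e = commutator≈ε⇒commute x y (trans (sym (⟦⟧-as-reduce x y)) e)

  commute⇒⟦⟧≡[] : ∀ (x y : Word k) → Commute x y → ⟦ x , y ⟧ ≡ []
  commute⇒⟦⟧≡[] x y c = trans (⟦⟧-as-reduce x y) (commute⇒commutator≈ε x y c)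

  ⟦⟧-injective : ∀ (x z z' : Word k) → ⟦ x , z ⟧ ≡ ⟦ x , z' ⟧ → Commute (inv z' ++ z) x
  ⟦⟧-injective x z z' e =
    commutator-injective x z z' (trans (sym (⟦⟧-as-reduce x z)) (trans e (⟦⟧-as-reduce x z')))

  quotient-trivial⇒≡ : ∀ (z z' : Word k) → IsReduced z → IsReduced z'
    → reduce (inv z' ++ z) ≡ [] → z ≡ z'
  quotient-trivial⇒≡ z z' rz rz' e =
    reduced-unique z z' rz rz' (sym (⁻¹-injective {z'} {z} (inverseˡ-unique (z' ⁻¹) z e)))

  length-⟦⟧ : ∀ (p q : Word k) → length ⟦ p , q ⟧ ≤ (length p + length q) + (length p + length q)
  length-⟦⟧ p q = begin
    length ⟦ p , q ⟧                                ≡⟨ cong length (⟦⟧-as-reduce p q) ⟩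
    length (reduce (((p ++ q) ++ inv p) ++ inv q))  ≤⟨ length-reduce (((p ++ q) ++ inv p) ++ inv q) ⟩
    length (((p ++ q) ++ inv p) ++ inv q)           ≡⟨ length-++ ((p ++ q) ++ inv p) ⟩
    length ((p ++ q) ++ inv p) + length (inv q)     ≡⟨ cong₂ _+_ (length-++ (p ++ q)) (length-inv q) ⟩
    (length (p ++ q) + length (inv p)) + length q   ≡⟨ cong₂ (λ x y → (x + y) + length q) (length-++ p) (length-inv p) ⟩
    ((length p + length q) + length p) + length q   ≡⟨ +-assoc (length p + length q) (length p) (length q) ⟩
    (length p + length q) + (length p + length q)   ∎
    where open ≤-Reasoning

all-pairs-or-counterexample : ∀ {A : Set} (P : A → A → Set) → (∀ x y → Dec (P x y)) → (xs : List A)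
  → (∀ {x y} → x ∈ xs → y ∈ xs → P x y) ⊎ Σ[ x ∈ A ] Σ[ y ∈ A ] (x ∈ xs × y ∈ xs × ¬ P x y)
all-pairs-or-counterexample P P? xs with any? (λ x → any? (λ y → ¬? (P? x y)) xs) xs
... | yes some with find some
...   | x , x∈ , some' with find some'
...     | y , y∈ , ¬p = inj₂ (x , y , x∈ , y∈ , ¬p)
all-pairs-or-counterexample P P? xs | no none =
  inj₁ λ x∈ y∈ → decidable-stable (P? _ _) (λ ¬p → none (lose x∈ (lose y∈ ¬p)))

module _ {k : ℕ} where

  open GroupLemmas (FreeGroup k)

  -- Pairwise commuting reduced words of length ≤ m: all of them lie in the
  -- centralizer of one nontrivial element, whose m-ball has 2m + 1 elements.
  abelian-case : ∀ m (xs : List (Word k)) → Unique xs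
    → All (λ x → IsReduced x × length x ≤ m) xs
    → (∀ {x y} → x ∈ xs → y ∈ xs → Commute x y)
    → length xs ≤ suc (m + m)
  abelian-case m xs unique short commuting with any? (λ x → ¬? (x ≟W [])) xs
  ... | yes some with find some
  ...   | x , x∈ , x≢[] = begin
    length xs    ≤⟨ length-≤-injection id xs (ball m) unique (λ _ _ e → e)
                      (λ z∈ → ∈-ball m _ (reduced z∈) (commuting z∈ x∈) (shorter z∈)) ⟩
    length (ball m) ≡⟨ length-ball m ⟩
    suc (m + m)  ∎
    where
    open ≤-Reasoning
    reduced : ∀ {z} → z ∈ xs → IsReduced z
    reduced z∈ = proj₁ (All.lookup short z∈)
    shorter : ∀ {z} → z ∈ xs → length z ≤ m
    shorter z∈ = proj₂ (All.lookup short z∈)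
    open CentralizerBalls (reduced x∈) (cyclic-decomposition x (reduced x∈) x≢[])
  abelian-case m xs unique short commuting | no none =
    ≤-trans (length-≤-injection id xs ([] ∷ []) unique (λ _ _ e → e) trivial) (s≤s z≤n)
    where
    trivial : ∀ {z} → z ∈ xs → z ∈ [] ∷ []
    trivial {z} z∈ = here (decidable-stable (z ≟W []) (λ z≢[] → none (lose z∈ z≢[])))

  -- If x, y ∈ W do not commute, then z ↦ ([x,z], [y,z]) is injective on W: equal
  -- values make z'⁻¹ z commute with x and y, which forces z'⁻¹ z = 1 because the
  -- centralizer of a nontrivial element is commutative.  Its coordinates commute
  -- with g = [x,y] ≠ 1 by hypothesis and have length ≤ 4m, and g has zero
  -- exponent sums, so each coordinate takes at most 4m + 1 values.
  nonabelian-case : (W : Word k → Set) → (∀ x → W x → IsReduced x)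
    → (∀ x₁ x₂ x₃ x₄ → W x₁ → W x₂ → W x₃ → W x₄ → ⟦ ⟦ x₁ , x₂ ⟧ , ⟦ x₃ , x₄ ⟧ ⟧ ≡ [])
    → ∀ m (xs : List (Word k)) → Unique xs → All (λ x → W x × length x ≤ m) xs
    → ∀ {x y} → x ∈ xs → y ∈ xs → ⟦ x , y ⟧ ≢ []
    → length xs ≤ suc ((m + m) + (m + m)) * suc ((m + m) + (m + m))
  nonabelian-case W W-reduced metabelian m xs unique short {x} {y} x∈ y∈ g≢[] = begin
    length xs                      ≤⟨ length-≤-injection f xs (cartesianProduct E E) unique injective into ⟩
    length (cartesianProduct E E)  ≡⟨ length-cartesianProduct E E ⟩
    length E * length E            ≡⟨ cong₂ _*_ (length-sparse-ball (m + m)) (length-sparse-ball (m + m)) ⟩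
    suc ((m + m) + (m + m)) * suc ((m + m) + (m + m)) ∎
    where
    open ≤-Reasoning
    g : Word k
    g = ⟦ x , y ⟧
    rg : IsReduced g
    rg = reduce-reduced (((x · y) · inv x) ++ inv y)
    open CentralizerBalls rg (cyclic-decomposition g rg g≢[])
    open Balanced (λ i → exp-sum-commutator i x y)
    E : List (Word k)
    E = sparse-ball (m + m)
    in-W : ∀ {z} → z ∈ xs → W z
    in-W z∈ = proj₁ (All.lookup short z∈)
    reduced : ∀ {z} → z ∈ xs → IsReduced z
    reduced z∈ = W-reduced _ (in-W z∈)
    shorter : ∀ {z} → z ∈ xs → length z ≤ m
    shorter z∈ = proj₂ (All.lookup short z∈)
    ⟦⟧∈E : ∀ {p z} → p ∈ xs → z ∈ xs → ⟦ p , z ⟧ ∈ E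
    ⟦⟧∈E {p} {z} p∈ z∈ = ∈-sparse-ball (m + m) ⟦ p , z ⟧ (reduce-reduced (((p · z) · inv p) ++ inv z))
      (⟦⟧≡[]⇒commute ⟦ p , z ⟧ g (metabelian p z x y (in-W p∈) (in-W z∈) (in-W x∈) (in-W y∈)))
      (≤-trans (length-⟦⟧ p z) (+-mono-≤ |p|+|z| |p|+|z|))
      where
      |p|+|z| : length p + length z ≤ m + m
      |p|+|z| = +-mono-≤ (shorter p∈) (shorter z∈)
    f : Word k → Word k × Word k
    f z = ⟦ x , z ⟧ , ⟦ y , z ⟧
    into : ∀ {z} → z ∈ xs → f z ∈ cartesianProduct E E
    into z∈ = ∈-cartesianProduct⁺ (⟦⟧∈E x∈ z∈) (⟦⟧∈E y∈ z∈)
    injective : ∀ {z z'} → z ∈ xs → z' ∈ xs → f z ≡ f z' → z ≡ z'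
    injective {z} {z'} z∈ z'∈ e with reduce (inv z' ++ z) ≟W []
    ... | yes trivial = quotient-trivial⇒≡ z z' (reduced z∈) (reduced z'∈) trivial
    ... | no nontrivial = ⊥-elim (g≢[] (commute⇒⟦⟧≡[] x y
      (centralizer-commutative x y (reduced x∈) (reduced y∈)
        (commutes-with-w₀ x (⟦⟧-injective x z z' (cong proj₁ e)))
        (commutes-with-w₀ y (⟦⟧-injective y z z' (cong proj₂ e))))))
      where
      w w₀ : Word k
      w = inv z' ++ z
      w₀ = reduce w
      rw₀ : IsReduced w₀
      rw₀ = reduce-reduced w
      open Centralizer rw₀ (cyclic-decomposition w₀ rw₀ nontrivial) using (centralizer-commutative)
      commutes-with-w₀ : ∀ p → Commute w p → Commute p w₀
      commutes-with-w₀ p c = commute-resp {p} {p} {w} {w₀} refl (sym (reduce-idempotent w))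
        (commute-sym {w} {p} c)

private
  ≤-by-excess : ∀ a b d → b ≡ a + d → a ≤ b
  ≤-by-excess a b d e = ≤-trans (m≤m+n a d) (≤-reflexive (sym e))

abelian-bound : ∀ m → suc (m + m) ≤ (4 * m + 1) * (8 * m + 1)
abelian-bound m = ≤-by-excess _ _ (m * (32 * m + 10)) (expand m)
  where
  expand : ∀ m → (4 * m + 1) * (8 * m + 1) ≡ suc (m + m) + m * (32 * m + 10)
  expand = NatSolver.solve-∀

nonabelian-bound : ∀ m → suc ((m + m) + (m + m)) * suc ((m + m) + (m + m)) ≤ (4 * m + 1) * (8 * m + 1)
nonabelian-bound m = ≤-by-excess _ _ (m * (16 * m + 4)) (expand m)
  where
  expand : ∀ m → (4 * m + 1) * (8 * m + 1)
    ≡ suc ((m + m) + (m + m)) * suc ((m + m) + (m + m)) + m * (16 * m + 4)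
  expand = NatSolver.solve-∀

bound-45 : ∀ m → 1 ≤ m → (4 * m + 1) * (8 * m + 1) ≤ 45 * (m * m)
bound-45 (suc n) _ = ≤-by-excess _ _ (n * (13 * n + 14)) (expand n)
  where
  expand : ∀ n → 45 * (suc n * suc n) ≡ (4 * suc n + 1) * (8 * suc n + 1) + n * (13 * n + 14)
  expand = NatSolver.solve-∀

proposition4p7 : (k : ℕ) → 2 ≤ k → (W : Word k → Set)
  → (∀ x → W x → IsReduced x)
  → (∀ x₁ x₂ x₃ x₄ → W x₁ → W x₂ → W x₃ → W x₄
       → ⟦ ⟦ x₁ , x₂ ⟧ , ⟦ x₃ , x₄ ⟧ ⟧ ≡ [])
  → (m : ℕ) → 1 ≤ m
  → (xs : List (Word k)) → Unique xs
  → All (λ x → W x × dist₁ x ≤ m) xs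
  → (Data.List.length xs ≤ (4 * m + 1) * (8 * m + 1))
    × ((4 * m + 1) * (8 * m + 1) ≤ 45 * (m * m))
proposition4p7 k _ W W-reduced metabelian m 1≤m xs unique short =
  count (all-pairs-or-counterexample (λ x y → ⟦ x , y ⟧ ≡ []) (λ x y → ⟦ x , y ⟧ ≟W []) xs) ,
  bound-45 m 1≤m
  where
  count : (∀ {x y} → x ∈ xs → y ∈ xs → ⟦ x , y ⟧ ≡ [])
        ⊎ Σ[ x ∈ Word k ] Σ[ y ∈ Word k ] (x ∈ xs × y ∈ xs × ⟦ x , y ⟧ ≢ [])
    → length xs ≤ (4 * m + 1) * (8 * m + 1)
  count (inj₁ commuting) = ≤-trans
    (abelian-case m xs unique (All.map (λ (w , le) → W-reduced _ w , le) short)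
      (λ {x} {y} x∈ y∈ → ⟦⟧≡[]⇒commute x y (commuting x∈ y∈)))
    (abelian-bound m)
  count (inj₂ (x , y , x∈ , y∈ , g≢[])) = ≤-trans
    (nonabelian-case W W-reduced metabelian m xs unique short x∈ y∈ g≢[])
    (nonabelian-bound m)
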